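{- Let $t$ be a power of two, let $h:[u]\to[t]$ be a hash function (where $[s]=\{0,\ldots,s-1\}$), let $S\subseteq[u]$ be a set of keys stored in a linear probing table $T$ of size $t$ using $h$ (the keys inserted in any order, starting from an empty table), and let $q\in[u]$ be any key (possibly in $S$). Let $\ell\ge 0$ be an integer and let $R$ be a run of $T$ of length $r\ge 2^{\ell+2}$. Then one of the first four dyadic $\ell$-intervals intersecting $R$ is near-full.
   Context: Linear probing: $T$ is an array indexed by $[t]$ whose entries are either empty or contain a key. To insert a key $x$ not already stored, scan locations $h(x),h(x)+1,h(x)+2,\ldots$ and place $x$ in the first empty location. Wrap-around from $t-1$ to $0$ is ignored, so a key $x$ is always placed at a location $i\ge h(x)$, and every location from $h(x)$ to the location of $x$ is filled. A run is a maximal interval of consecutive filled locations of $T$. A (dyadic) $\ell$-interval is an interval of locations of the form $[i2^\ell,(i+1)2^\ell)$ with $i\in[t/2^\ell]$. A key $x$ hashes into an interval $I$ if $h(x)\in I$. An $\ell$-interval $I$ is near-full if at least $\frac34 2^\ell$ keys from $S\setminus\{q\}$ hash into $I$. -}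

module Defs where

open import Data.Nat using (ℕ; zero; suc; _+_; _*_; _∸_; _^_; _≤_; _<_; _<?_; _≤?_)
open import Data.Fin using (Fin; toℕ; fromℕ<)
open import Data.Fin.Properties using () renaming (_≟_ to _≟ᶠ_)
open import Data.Maybe using (Maybe; just; nothing)
open import Data.List using (List; []; _∷_)
open import Data.Product using (Σ; _×_; _,_; ∃)
open import Data.Sum using (_⊎_)
open import Relation.Nullary using (¬_; Dec; yes; no)
open import Relation.Binary.PropositionalEquality using (_≡_; _≢_)

Table : ℕ → ℕ → Set
Table u t = Fin t → Maybe (Fin u)

empty : ∀ {u t} → Table u t
empty _ = nothing

-- Content of location p (a natural number); locations outside [t] read as empty.
at : ∀ {u t} → Table u t → ℕ → Maybe (Fin u)
at {t = t} T p with p <? t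
... | yes p<t = T (fromℕ< p<t)
... | no _    = nothing

Filled : ∀ {u t} → Table u t → ℕ → Set
Filled T p = at T p ≢ nothing

Empty : ∀ {u t} → Table u t → ℕ → Set
Empty T p = at T p ≡ nothing

Write : ∀ {u t} → Table u t → ℕ → Fin u → Table u t → Set
Write T j x T' = ∀ (i : Fin _) → (toℕ i ≡ j → T' i ≡ just x) × (toℕ i ≢ j → T' i ≡ T i)

-- Linear-probing insertion (no wrap-around): x is placed at the first empty
-- location j ≥ h(x); j must lie in [t].
Insert : ∀ {u t} → (Fin u → Fin t) → Table u t → Fin u → Table u t → Set
Insert {t = t} h T x T' =
  Σ ℕ λ j → (toℕ (h x) ≤ j) × (j < t) × Empty T j × Filled' j × Write T j x T'
  where
  Filled' : ℕ → Set
  Filled' j = ∀ i → toℕ (h x) ≤ i → i < j → Filled T i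

data Built {u t} (h : Fin u → Fin t) : Table u t → List (Fin u) → Table u t → Set where
  done : ∀ {T} → Built h T [] T
  step : ∀ {T T' T'' x xs} → Insert h T x T' → Built h T' xs T'' → Built h T (x ∷ xs) T''

IsRun : ∀ {u t} → Table u t → ℕ → ℕ → Set
IsRun T a r =
  (1 ≤ r) × (∀ p → a ≤ p → p < a + r → Filled T p)
  × (a ≡ 0 ⊎ Empty T (a ∸ 1)) × Empty T (a + r)

-- The ℓ-interval with index i is [i 2^ℓ, (i+1) 2^ℓ); it is an ℓ-interval of the
-- table when i ∈ [t / 2^ℓ], i.e. (i+1) 2^ℓ ≤ t.
IsInterval : ℕ → ℕ → ℕ → Set
IsInterval t ℓ i = suc i * 2 ^ ℓ ≤ t

Intersects : ℕ → ℕ → ℕ → ℕ → Set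
Intersects ℓ i a r = (i * 2 ^ ℓ < a + r) × (a < suc i * 2 ^ ℓ)

countInto : ∀ {u t} → (Fin u → Fin t) → List (Fin u) → Fin u → ℕ → ℕ → ℕ
countInto h [] q ℓ i = 0
countInto h (x ∷ S) q ℓ i with x ≟ᶠ q | i * 2 ^ ℓ ≤? toℕ (h x) | toℕ (h x) <? suc i * 2 ^ ℓ
... | no _ | yes _ | yes _ = suc (countInto h S q ℓ i)
... | _    | _     | _     = countInto h S q ℓ i

NearFull : ∀ {u t} → (Fin u → Fin t) → List (Fin u) → Fin u → ℕ → ℕ → Set
NearFull h S q ℓ i = 3 * 2 ^ ℓ ≤ 4 * countInto h S q ℓ i

module Submission where

-- Call a location lo "left-closed" in T if lo = 0 or
-- location lo - 1 is empty.  The classical invariant of linear probing without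
-- wrap-around is: for every left-closed lo, the number of filled locations in
-- [lo, lo + n) is at most the number of stored keys hashing into [lo, lo + n),
-- because a key is only ever placed to the right of its hash and its probe
-- sequence never crosses an empty location.  Applied to a run R = [a, a + r)
-- this says that any prefix of R of length p contains at least p hashes.
--
-- Let m = 2^ℓ and let i₀ be the index of the ℓ-interval containing a.  Since
-- r ≥ 4m, the run covers [a, (i₀ + 4) m), a prefix of length more than 3m, so
-- more than 3m keys hash into the four ℓ-intervals i₀, …, i₀ + 3, and at
-- least 3m of them differ from q.  Some interval receives at least a quarter
-- of them, i.e. is near-full; these four are exactly the first four
-- ℓ-intervals meeting R.

open import Defs
open import Data.Nat using (ℕ; zero; suc; _+_; _*_; _∸_; _^_; _≤_; _<_; z≤n; s≤s; _≤?_; _<?_; NonZero)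
open import Data.Nat.Properties
open import Data.Nat.DivMod using (_/_; _%_; m/n*n≤m; m≡m%n+[m/n]*n; m%n<n)
open import Data.Nat.Tactic.RingSolver using (solve-∀)
open import Data.Fin using (Fin; toℕ; fromℕ<)
open import Data.Fin.Properties using (toℕ-fromℕ<) renaming (_≟_ to _≟ᶠ_)
open import Data.Maybe using (Maybe; just; nothing)
open import Data.List using (List; []; _∷_; _++_; filter)
open import Data.List.Properties using (++-assoc; ++-identityʳ; filter-all)
open import Data.List.Relation.Unary.All as All using (All)
open import Data.List.Relation.Unary.AllPairs using ([]; _∷_)
open import Data.List.Relation.Unary.Unique.Propositional using (Unique)
open import Data.Product using (Σ; _×_; ∃; _,_; proj₁; proj₂)
open import Data.Sum using (_⊎_; inj₁; inj₂)
open import Relation.Nullary using (¬_; Dec; yes; no; ¬?; contradiction)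
open import Relation.Binary.PropositionalEquality using (_≡_; refl; sym; trans; cong; cong₂; subst; _≢_)

sumBelow : ℕ → (ℕ → ℕ) → ℕ
sumBelow zero    c = 0
sumBelow (suc n) c = c n + sumBelow n c

someTermAtLeastAverage : ∀ n (c : ℕ → ℕ) →
  ∃ λ k → k < suc n × sumBelow (suc n) c ≤ suc n * c k
someTermAtLeastAverage zero    c = 0 , s≤s z≤n , ≤-refl
someTermAtLeastAverage (suc n) c with someTermAtLeastAverage n c
... | k , k<1+n , sum≤ with c k ≤? c (suc n)
...   | yes ck≤cn = suc n , ≤-refl , +-monoʳ-≤ (c (suc n)) (≤-trans sum≤ (*-monoʳ-≤ (suc n) ck≤cn))
...   | no  ck≰cn = k , m<n⇒m<1+n k<1+n , +-mono-≤ (<⇒≤ (≰⇒> ck≰cn)) sum≤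

blockOf : ∀ a m .{{_ : NonZero m}} → (a / m) * m ≤ a × a < suc (a / m) * m
blockOf a m = m/n*n≤m a m , (begin-strict
    a                     ≡⟨ m≡m%n+[m/n]*n a m ⟩
    a % m + (a / m) * m   <⟨ +-monoˡ-< ((a / m) * m) (m%n<n a m) ⟩
    m + (a / m) * m       ∎)
  where open ≤-Reasoning

inside : ℕ → ℕ → ℕ → ℕ
inside lo hi y with lo ≤? y | y <? hi
... | yes _ | yes _ = 1
... | _     | _     = 0

inside≤1 : ∀ lo hi y → inside lo hi y ≤ 1
inside≤1 lo hi y with lo ≤? y | y <? hi
... | yes _ | yes _ = ≤-refl
... | yes _ | no _  = z≤n
... | no _  | _     = z≤n

inside-in : ∀ {lo hi y} → lo ≤ y → y < hi → inside lo hi y ≡ 1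
inside-in {lo} {hi} {y} lo≤y y<hi with lo ≤? y | y <? hi
... | yes _ | yes _    = refl
... | yes _ | no y≮hi  = contradiction y<hi y≮hi
... | no lo≰y | _      = contradiction lo≤y lo≰y

inside-below : ∀ {lo hi y} → y < lo → inside lo hi y ≡ 0
inside-below {lo} {hi} {y} y<lo with lo ≤? y | y <? hi
... | yes lo≤y | yes _ = contradiction lo≤y (<⇒≱ y<lo)
... | yes _    | no _  = refl
... | no _     | _     = refl

inside-above : ∀ {lo hi y} → hi ≤ y → inside lo hi y ≡ 0
inside-above {lo} {hi} {y} hi≤y with lo ≤? y | y <? hi
... | yes _ | yes y<hi = contradiction hi≤y (<⇒≱ y<hi)
... | yes _ | no _     = refl
... | no _  | _        = refl

inside-empty : ∀ {lo hi} y → hi ≤ lo → inside lo hi y ≡ 0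
inside-empty {lo} {hi} y hi≤lo = byCases (y <? hi)
  where
  byCases : Dec (y < hi) → inside lo hi y ≡ 0
  byCases (yes y<hi) = inside-below (<-≤-trans y<hi hi≤lo)
  byCases (no  y≮hi) = inside-above (≮⇒≥ y≮hi)

inside-split : ∀ {lo mid hi} y → inside lo hi y ≤ inside lo mid y + inside mid hi y
inside-split {lo} {mid} {hi} y = byCases (y <? mid) (lo ≤? y) (y <? hi)
  where
  byCases : Dec (y < mid) → Dec (lo ≤ y) → Dec (y < hi) →
    inside lo hi y ≤ inside lo mid y + inside mid hi y
  byCases (yes y<mid) (yes lo≤y) _ =
    ≤-trans (inside≤1 lo hi y) (≤-trans (≤-reflexive (sym (inside-in lo≤y y<mid))) (m≤m+n _ _))
  byCases (yes _)     (no lo≰y)  _ = ≤-trans (≤-reflexive (inside-below (≰⇒> lo≰y))) z≤n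
  byCases (no y≮mid)  _ (yes y<hi) =
    ≤-trans (inside≤1 lo hi y) (≤-trans (≤-reflexive (sym (inside-in (≮⇒≥ y≮mid) y<hi))) (m≤n+m _ _))
  byCases (no _)      _ (no y≮hi)  = ≤-trans (≤-reflexive (inside-above (≮⇒≥ y≮hi))) z≤n

inside-monoˡ : ∀ {lo' lo hi} y → lo' ≤ lo → inside lo hi y ≤ inside lo' hi y
inside-monoˡ {lo'} {lo} {hi} y lo'≤lo = byCases (lo ≤? y) (y <? hi)
  where
  byCases : Dec (lo ≤ y) → Dec (y < hi) → inside lo hi y ≤ inside lo' hi y
  byCases (yes lo≤y) (yes y<hi) =
    ≤-trans (inside≤1 lo hi y) (≤-reflexive (sym (inside-in (≤-trans lo'≤lo lo≤y) y<hi)))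
  byCases (no lo≰y)  _          = ≤-trans (≤-reflexive (inside-below (≰⇒> lo≰y))) z≤n
  byCases (yes _)    (no y≮hi)  = ≤-trans (≤-reflexive (inside-above (≮⇒≥ y≮hi))) z≤n

module Hashing {u t : ℕ} (h : Fin u → Fin t) where

  hashedInto : List (Fin u) → ℕ → ℕ → ℕ
  hashedInto []       lo hi = 0
  hashedInto (x ∷ xs) lo hi = inside lo hi (toℕ (h x)) + hashedInto xs lo hi

  hashedInto-snoc : ∀ xs x lo hi →
    hashedInto (xs ++ x ∷ []) lo hi ≡ hashedInto xs lo hi + inside lo hi (toℕ (h x))
  hashedInto-snoc []       x lo hi = +-identityʳ (inside lo hi (toℕ (h x)))
  hashedInto-snoc (y ∷ xs) x lo hi =
    trans (cong (inside lo hi (toℕ (h y)) +_) (hashedInto-snoc xs x lo hi))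
          (sym (+-assoc (inside lo hi (toℕ (h y))) _ _))

  hashedInto-empty : ∀ xs {lo hi} → hi ≤ lo → hashedInto xs lo hi ≡ 0
  hashedInto-empty []       hi≤lo = refl
  hashedInto-empty (x ∷ xs) hi≤lo =
    cong₂ _+_ (inside-empty (toℕ (h x)) hi≤lo) (hashedInto-empty xs hi≤lo)

  hashedInto-split : ∀ xs {lo mid hi} →
    hashedInto xs lo hi ≤ hashedInto xs lo mid + hashedInto xs mid hi
  hashedInto-split []       = z≤n
  hashedInto-split (x ∷ xs) {lo} {mid} {hi} = begin
    inside lo hi y + hashedInto xs lo hi
      ≤⟨ +-mono-≤ (inside-split y) (hashedInto-split xs) ⟩
    (inside lo mid y + inside mid hi y) + (hashedInto xs lo mid + hashedInto xs mid hi)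
      ≡⟨ interchange (inside lo mid y) (inside mid hi y) _ _ ⟩
    (inside lo mid y + hashedInto xs lo mid) + (inside mid hi y + hashedInto xs mid hi) ∎
    where
    open ≤-Reasoning
    y : ℕ
    y = toℕ (h x)
    interchange : ∀ a b c d → (a + b) + (c + d) ≡ (a + c) + (b + d)
    interchange = solve-∀

  hashedInto-monoˡ : ∀ xs {lo' lo hi} → lo' ≤ lo → hashedInto xs lo hi ≤ hashedInto xs lo' hi
  hashedInto-monoˡ []       lo'≤lo = z≤n
  hashedInto-monoˡ (x ∷ xs) lo'≤lo =
    +-mono-≤ (inside-monoˡ (toℕ (h x)) lo'≤lo) (hashedInto-monoˡ xs lo'≤lo)

  hashedInto-blocks : ∀ xs m i n →
    hashedInto xs (i * m) ((i + n) * m)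
      ≤ sumBelow n (λ k → hashedInto xs ((i + k) * m) (suc (i + k) * m))
  hashedInto-blocks xs m i zero =
    ≤-reflexive (hashedInto-empty xs (*-monoˡ-≤ m (≤-reflexive (+-identityʳ i))))
  hashedInto-blocks xs m i (suc n) rewrite +-suc i n = begin
    hashedInto xs (i * m) (suc (i + n) * m)
      ≤⟨ hashedInto-split xs ⟩
    hashedInto xs (i * m) ((i + n) * m) + block n
      ≤⟨ +-monoˡ-≤ (block n) (hashedInto-blocks xs m i n) ⟩
    sumBelow n block + block n
      ≡⟨ +-comm (sumBelow n block) (block n) ⟩
    block n + sumBelow n block ∎
    where
    open ≤-Reasoning
    block : ℕ → ℕ
    block k = hashedInto xs ((i + k) * m) (suc (i + k) * m)

  others : Fin u → List (Fin u) → List (Fin u)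
  others q = filter (λ x → ¬? (x ≟ᶠ q))

  hashedInto-others : ∀ q {xs} → Unique xs → ∀ lo hi →
    hashedInto xs lo hi ≤ suc (hashedInto (others q xs) lo hi)
  hashedInto-others q [] lo hi = z≤n
  hashedInto-others q {x ∷ xs} (x∉xs ∷ unique) lo hi with x ≟ᶠ q
  ... | yes refl =
    subst (λ ys → inside lo hi (toℕ (h x)) + hashedInto xs lo hi ≤ suc (hashedInto ys lo hi))
          (sym (filter-all (λ y → ¬? (y ≟ᶠ x)) (All.map (λ x≢y y≡x → x≢y (sym y≡x)) x∉xs)))
          (+-monoˡ-≤ (hashedInto xs lo hi) (inside≤1 lo hi (toℕ (h x))))
  ... | no _ =
    ≤-trans (+-monoʳ-≤ (inside lo hi (toℕ (h x))) (hashedInto-others q unique lo hi))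
            (≤-reflexive (+-suc _ _))

  countInto≡hashedInto : ∀ S q ℓ i →
    countInto h S q ℓ i ≡ hashedInto (others q S) (i * 2 ^ ℓ) (suc i * 2 ^ ℓ)
  countInto≡hashedInto []      q ℓ i = refl
  countInto≡hashedInto (x ∷ S) q ℓ i
    with x ≟ᶠ q | i * 2 ^ ℓ ≤? toℕ (h x) | toℕ (h x) <? suc i * 2 ^ ℓ
  ... | yes _ | _     | _     = countInto≡hashedInto S q ℓ i
  ... | no _  | yes lo≤y | yes y<hi =
    cong₂ _+_ (sym (inside-in lo≤y y<hi)) (countInto≡hashedInto S q ℓ i)
  ... | no _  | yes _    | no y≮hi  =
    cong₂ _+_ (sym (inside-above (≮⇒≥ y≮hi))) (countInto≡hashedInto S q ℓ i)
  ... | no _  | no lo≰y  | _        =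
    cong₂ _+_ (sym (inside-below (≰⇒> lo≰y))) (countInto≡hashedInto S q ℓ i)

module _ {u t : ℕ} where

  at-empty : ∀ p → at (empty {u} {t}) p ≡ nothing
  at-empty p with p <? t
  ... | yes _ = refl
  ... | no _  = refl

  filled⇒<t : (T : Table u t) (p : ℕ) → Filled T p → p < t
  filled⇒<t T p filled with p <? t
  ... | yes p<t = p<t
  ... | no _    = contradiction refl filled

  run-end≤t : ∀ {T : Table u t} {a r} → IsRun T a r → a + r ≤ t
  run-end≤t {T} {a} {suc r} (_ , filled , _ , _) =
    subst (_≤ t) (sym (+-suc a r)) (filled⇒<t T (a + r) (filled (a + r) (m≤m+n a r) (+-monoʳ-< a ≤-refl)))

  at-write-here : ∀ {T T' : Table u t} {j x} → Write T j x T' → j < t → at T' j ≡ just x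
  at-write-here {j = j} write j<t with j <? t
  ... | yes j<t' = proj₁ (write (fromℕ< j<t')) (toℕ-fromℕ< j<t')
  ... | no j≮t   = contradiction j<t j≮t

  at-write-other : ∀ {T T' : Table u t} {j x} → Write T j x T' → ∀ p → p ≢ j → at T' p ≡ at T p
  at-write-other write p p≢j with p <? t
  ... | yes p<t = proj₂ (write (fromℕ< p<t)) (λ eq → p≢j (trans (sym (toℕ-fromℕ< p<t)) eq))
  ... | no _    = refl

  occupancy : Maybe (Fin u) → ℕ
  occupancy nothing  = 0
  occupancy (just _) = 1

  occupancy≤1 : ∀ c → occupancy c ≤ 1
  occupancy≤1 nothing  = z≤n
  occupancy≤1 (just _) = ≤-refl

  occupied : Table u t → ℕ → ℕ → ℕ
  occupied T lo zero    = 0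
  occupied T lo (suc n) = occupancy (at T (lo + n)) + occupied T lo n

  occupied-empty : ∀ lo n → occupied empty lo n ≡ 0
  occupied-empty lo zero    = refl
  occupied-empty lo (suc n) = cong₂ _+_ (cong occupancy (at-empty (lo + n))) (occupied-empty lo n)

  occupied-full : (T : Table u t) → ∀ lo n →
    (∀ p → lo ≤ p → p < lo + n → Filled T p) → occupied T lo n ≡ n
  occupied-full T lo zero    filled = refl
  occupied-full T lo (suc n) filled =
    cong₂ _+_ (isJust (filled (lo + n) (m≤m+n lo n) (+-monoʳ-< lo ≤-refl)))
              (occupied-full T lo n (λ p lo≤p p<lo+n → filled p lo≤p (<-≤-trans p<lo+n (+-monoʳ-≤ lo (n≤1+n n)))))
    where
    isJust : ∀ {c} → c ≢ nothing → occupancy c ≡ 1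
    isJust {nothing} c≢nothing = contradiction refl c≢nothing
    isJust {just _}  _         = refl

  occupied-write-outside : ∀ {T T' : Table u t} {j x} → Write T j x T' → ∀ lo n →
    j < lo ⊎ lo + n ≤ j → occupied T' lo n ≡ occupied T lo n
  occupied-write-outside write lo zero    outside = refl
  occupied-write-outside {j = j} write lo (suc n) outside =
    cong₂ _+_ (cong occupancy (at-write-other write (lo + n) (lastOutside outside)))
              (occupied-write-outside write lo n (restOutside outside))
    where
    lastOutside : j < lo ⊎ lo + suc n ≤ j → lo + n ≢ j
    lastOutside (inj₁ j<lo)  eq = <⇒≱ j<lo (≤-trans (m≤m+n lo n) (≤-reflexive eq))
    lastOutside (inj₂ end≤j) eq = <⇒≢ (<-≤-trans (+-monoʳ-< lo ≤-refl) end≤j) eq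
    restOutside : j < lo ⊎ lo + suc n ≤ j → j < lo ⊎ lo + n ≤ j
    restOutside (inj₁ j<lo)  = inj₁ j<lo
    restOutside (inj₂ end≤j) = inj₂ (≤-trans (+-monoʳ-≤ lo (n≤1+n n)) end≤j)

  occupied-write : ∀ {T T' : Table u t} {j x} → Write T j x T' → ∀ lo n →
    occupied T' lo n ≤ suc (occupied T lo n)
  occupied-write write lo zero = z≤n
  occupied-write {T} {T'} {j} write lo (suc n) with lo + n ≟ j
  ... | yes refl = begin
    occupancy (at T' (lo + n)) + occupied T' lo n
      ≤⟨ +-monoˡ-≤ (occupied T' lo n) (occupancy≤1 (at T' (lo + n))) ⟩
    suc (occupied T' lo n)
      ≡⟨ cong suc (occupied-write-outside write lo n (inj₂ ≤-refl)) ⟩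
    suc (occupied T lo n)
      ≤⟨ s≤s (m≤n+m _ _) ⟩
    suc (occupancy (at T (lo + n)) + occupied T lo n) ∎
    where open ≤-Reasoning
  ... | no lo+n≢j rewrite at-write-other write (lo + n) lo+n≢j =
    ≤-trans (+-monoʳ-≤ (occupancy (at T (lo + n))) (occupied-write write lo n)) (≤-reflexive (+-suc _ _))

module Probing {u t : ℕ} (h : Fin u → Fin t) where
  open Hashing h

  LeftClosed : Table u t → ℕ → Set
  LeftClosed T lo = lo ≡ 0 ⊎ Empty T (lo ∸ 1)

  Invariant : Table u t → List (Fin u) → Set
  Invariant T K = ∀ lo n → LeftClosed T lo → occupied T lo n ≤ hashedInto K lo (lo + n)

  leftClosed-before-write : ∀ {T T' : Table u t} {j x lo} → Write T j x T' → j < t →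
    LeftClosed T' lo → LeftClosed T lo
  leftClosed-before-write write j<t (inj₁ lo≡0)   = inj₁ lo≡0
  leftClosed-before-write {T} {T'} {j} {x} {lo} write j<t (inj₂ empty') =
    inj₂ (trans (sym (at-write-other write (lo ∸ 1) before≢j)) empty')
    where
    before≢j : lo ∸ 1 ≢ j
    before≢j refl = contradiction (trans (sym (at-write-here write j<t)) empty') λ ()

  probe-cannot-cross : ∀ {T : Table u t} {lo j y} → LeftClosed T lo → lo ≤ j →
    (∀ i → y ≤ i → i < j → Filled T i) → ¬ y < lo
  probe-cannot-cross (inj₁ refl) _ _ ()
  probe-cannot-cross {lo = suc l} (inj₂ empty) l<j filled (s≤s y≤l) = filled l y≤l l<j empty

  invariant-step : ∀ {T T' : Table u t} {x K} → Invariant T K → Insert h T x T' →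
    Invariant T' (K ++ x ∷ [])
  invariant-step {T} {T'} {x} {K} inv (j , y≤j , j<t , _ , probed , write) lo n closed' =
    byCases (lo ≤? j) (j <? lo + n)
    where
    open ≤-Reasoning
    y : ℕ
    y = toℕ (h x)
    closed : LeftClosed T lo
    closed = leftClosed-before-write write j<t closed'
    unchanged : j < lo ⊎ lo + n ≤ j → occupied T' lo n ≤ hashedInto (K ++ x ∷ []) lo (lo + n)
    unchanged outside = begin
      occupied T' lo n                               ≡⟨ occupied-write-outside write lo n outside ⟩
      occupied T lo n                                ≤⟨ inv lo n closed ⟩
      hashedInto K lo (lo + n)                       ≤⟨ m≤m+n _ _ ⟩
      hashedInto K lo (lo + n) + inside lo (lo + n) y ≡⟨ hashedInto-snoc K x lo (lo + n) ⟨
      hashedInto (K ++ x ∷ []) lo (lo + n)           ∎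
    byCases : Dec (lo ≤ j) → Dec (j < lo + n) →
      occupied T' lo n ≤ hashedInto (K ++ x ∷ []) lo (lo + n)
    byCases (yes lo≤j) (yes j<end) = begin
      occupied T' lo n                                ≤⟨ occupied-write write lo n ⟩
      suc (occupied T lo n)                           ≤⟨ s≤s (inv lo n closed) ⟩
      suc (hashedInto K lo (lo + n))                  ≡⟨ +-comm 1 _ ⟩
      hashedInto K lo (lo + n) + 1                    ≡⟨ cong (_ +_) (inside-in lo≤y (≤-<-trans y≤j j<end)) ⟨
      hashedInto K lo (lo + n) + inside lo (lo + n) y ≡⟨ hashedInto-snoc K x lo (lo + n) ⟨
      hashedInto (K ++ x ∷ []) lo (lo + n)            ∎
      where
      lo≤y : lo ≤ y
      lo≤y = ≮⇒≥ (probe-cannot-cross closed lo≤j probed)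
    byCases (yes _)    (no j≮end) = unchanged (inj₂ (≮⇒≥ j≮end))
    byCases (no lo≰j)  _          = unchanged (inj₁ (≰⇒> lo≰j))

  invariant-built : ∀ {T T'' : Table u t} {xs K} → Invariant T K → Built h T xs T'' →
    Invariant T'' (K ++ xs)
  invariant-built {T} {K = K} inv done = subst (Invariant T) (sym (++-identityʳ K)) inv
  invariant-built {T'' = T''} {x ∷ xs} {K} inv (step insert built) =
    subst (Invariant T'') (++-assoc K (x ∷ []) xs)
      (invariant-built {K = K ++ x ∷ []} (invariant-step {K = K} inv insert) built)

  run-prefix-load : ∀ {S T a r} → Built h empty S T → IsRun T a r →
    ∀ p → p ≤ r → p ≤ hashedInto S a (a + p)
  run-prefix-load {S} {T} {a} built (_ , filled , closed , _) p p≤r = begin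
    p                       ≡⟨ occupied-full T a p inRun ⟨
    occupied T a p          ≤⟨ invariant-built {K = []} emptyInvariant built a p closed ⟩
    hashedInto S a (a + p)  ∎
    where
    open ≤-Reasoning
    inRun : ∀ i → a ≤ i → i < a + p → Filled T i
    inRun i a≤i i<a+p = filled i a≤i (<-≤-trans i<a+p (+-monoʳ-≤ a p≤r))
    emptyInvariant : Invariant empty []
    emptyInvariant lo n _ = ≤-reflexive (occupied-empty lo n)

  -- If a run starts in the block [i m, (i + 1) m) and covers the blocks
  -- i, …, i + n, then at least n m + 1 keys hash into these blocks, so at least
  -- n m keys other than q do.
  window-load : ∀ {S T a r} → Unique S → Built h empty S T → IsRun T a r →
    ∀ q m i n → i * m ≤ a → a < suc i * m → (i + suc n) * m ≤ a + r →
    n * m ≤ sumBelow (suc n) (λ k → hashedInto (others q S) ((i + k) * m) (suc (i + k) * m))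
  window-load {S} {T} {a} {r} unique built run q m i n im≤a a<block E≤end = ≤-pred (begin
    suc (n * m)                              ≤⟨ m+n≤o⇒m≤o∸n (suc (n * m)) prefixLong ⟩
    p                                        ≤⟨ run-prefix-load built run p p≤r ⟩
    hashedInto S a (a + p)                   ≡⟨ cong (hashedInto S a) a+p≡E ⟩
    hashedInto S a E                         ≤⟨ hashedInto-monoˡ S im≤a ⟩
    hashedInto S (i * m) E                   ≤⟨ hashedInto-others q unique (i * m) E ⟩
    suc (hashedInto (others q S) (i * m) E)  ≤⟨ s≤s (hashedInto-blocks (others q S) m i (suc n)) ⟩
    suc (sumBelow (suc n) block)             ∎)
    where
    open ≤-Reasoning
    E p : ℕ
    E = (i + suc n) * m
    p = E ∸ a
    block : ℕ → ℕ
    block k = hashedInto (others q S) ((i + k) * m) (suc (i + k) * m)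
    blocksSum : ∀ n m i → n * m + suc i * m ≡ (i + suc n) * m
    blocksSum = solve-∀
    prefixLong : suc (n * m) + a ≤ E
    prefixLong = begin
      suc (n * m) + a     ≡⟨ +-suc (n * m) a ⟨
      n * m + suc a       ≤⟨ +-monoʳ-≤ (n * m) a<block ⟩
      n * m + suc i * m   ≡⟨ blocksSum n m i ⟩
      E                   ∎
    a+p≡E : a + p ≡ E
    a+p≡E = m+[n∸m]≡n (m+n≤o⇒n≤o (suc (n * m)) prefixLong)
    p≤r : p ≤ r
    p≤r = ≤-trans (∸-monoˡ-≤ a E≤end) (≤-reflexive (m+n∸m≡n a r))

candidate-interval : ∀ t ℓ a r i n → i * 2 ^ ℓ ≤ a → a < suc i * 2 ^ ℓ →
  (i + n) * 2 ^ ℓ ≤ a + r → a + r ≤ t → ∀ k → k < n →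
  IsInterval t ℓ (i + k) × Intersects ℓ (i + k) a r
    × (∀ j → IsInterval t ℓ j → Intersects ℓ j a r → i + k < j + n)
candidate-interval t ℓ a r i n im≤a a<block window≤end end≤t k k<n =
  ≤-trans blockEnd≤end end≤t
  , (<-≤-trans (m<n+m ((i + k) * m) (m^n>0 2 ℓ)) blockEnd≤end
    , <-≤-trans a<block (*-monoˡ-≤ m (s≤s (m≤m+n i k))))
  , λ j _ meets → +-mono-≤-< (i≤j (proj₂ meets)) k<n
  where
  m : ℕ
  m = 2 ^ ℓ
  blockEnd≤end : suc (i + k) * m ≤ a + r
  blockEnd≤end = ≤-trans (*-monoˡ-≤ m (≤-trans (≤-reflexive (sym (+-suc i k))) (+-monoʳ-≤ i k<n))) window≤end
  i≤j : ∀ {j} → a < suc j * m → i ≤ j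
  i≤j a<blockj = ≮⇒≥ λ j<i → <⇒≱ a<blockj (≤-trans (*-monoˡ-≤ m j<i) im≤a)

lemma1 : (u t : ℕ) → (∃ λ k → t ≡ 2 ^ k) → (h : Fin u → Fin t)
    → (S : List (Fin u)) → Unique S → (T : Table u t) → Built h empty S T
    → (q : Fin u) → (ℓ a r : ℕ) → IsRun T a r → 2 ^ (ℓ + 2) ≤ r
    → Σ ℕ λ i → IsInterval t ℓ i × Intersects ℓ i a r
    × (∀ j → IsInterval t ℓ j → Intersects ℓ j a r → i < j + 4)
    × NearFull h S q ℓ i
lemma1 u t _ h S unique T built q ℓ a r run 4m≤r =
  let (k , k<4 , load≤4block) = someTermAtLeastAverage 3 block
      (inTable , meets , amongFirstFour) =
        candidate-interval t ℓ a r i₀ 4 i₀m≤a a<block window≤end (run-end≤t run) k k<4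
  in i₀ + k , inTable , meets , amongFirstFour , nearFull k (≤-trans load load≤4block)
  where
  open Hashing h
  open Probing h
  m : ℕ
  m = 2 ^ ℓ
  instance
    m≢0 : NonZero m
    m≢0 = m^n≢0 2 ℓ
  i₀ : ℕ
  i₀ = a / m
  i₀m≤a : i₀ * m ≤ a
  i₀m≤a = proj₁ (blockOf a m)
  a<block : a < suc i₀ * m
  a<block = proj₂ (blockOf a m)
  window≤end : (i₀ + 4) * m ≤ a + r
  window≤end = begin
    (i₀ + 4) * m   ≡⟨ distrib i₀ m ⟩
    i₀ * m + m * 4 ≤⟨ +-mono-≤ i₀m≤a (subst (_≤ r) (^-distribˡ-+-* 2 ℓ 2) 4m≤r) ⟩
    a + r          ∎
    where
    open ≤-Reasoning
    distrib : ∀ i m → (i + 4) * m ≡ i * m + m * 4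
    distrib = solve-∀
  block : ℕ → ℕ
  block k = hashedInto (others q S) ((i₀ + k) * m) (suc (i₀ + k) * m)
  load : 3 * m ≤ sumBelow 4 block
  load = window-load unique built run q m i₀ 3 i₀m≤a a<block window≤end
  nearFull : ∀ k → 3 * m ≤ 4 * block k → NearFull h S q ℓ (i₀ + k)
  nearFull k = subst (λ c → 3 * m ≤ 4 * c) (sym (countInto≡hashedInto S q ℓ (i₀ + k)))
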